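{- Let $W=G(m,m,2)$ (the dihedral group of order $2m$) for some $m\ge 2$. Then the absolute order $\mathrm{Abs}(W)$ admits a normalized flow with respect to the weight function $\nu\equiv 1$.
   Context: $G(m,m,2)$ is the group of $2\times2$ monomial matrices with nonzero entries $m$-th roots of unity whose product of nonzero entries is $1$; it is a reflection group with reflections the elements whose fixed space in $\mathbb{C}^2$ has codimension 1. $\ell_R$ is reflection length and $\mathrm{Abs}(W)$ is the order $u\le v$ iff $\ell_R(u)+\ell_R(u^{ -1}v)=\ell_R(v)$, ranked by $\ell_R$. A normalized flow on a ranked poset $P=P_0\sqcup\cdots\sqcup P_r$ with vertex weights $\nu\ge0$ is a function $f\ge0$ on cover relations such that for each $i$ and each $a\in P_i$, $\sum_{b\in P_{i+1}, a\lessdot b}f(a,b)=\nu(a)/\nu(P_i)$, and for each $b\in P_{i+1}$, $\sum_{a\in P_i,a\lessdot b}f(a,b)=\nu(b)/\nu(P_{i+1})$, where $\nu(X)=\sum_{x\in X}\nu(x)$. -}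

module Defs where

open import Data.Nat using (ℕ; zero; suc; _+_; _∸_; _≤_; NonZero)
open import Data.Nat.DivMod using (_mod_)
open import Data.Fin using (Fin; toℕ)
open import Data.Bool using (Bool; true; false; not)
open import Data.List using (List; []; _∷_; foldr; map; length)
open import Data.List.Relation.Unary.All using (All)
open import Data.List.Relation.Unary.Unique.Propositional using (Unique)
open import Data.List.Membership.Propositional using (_∈_)
open import Data.Product using (_×_; ∃; ∃-syntax)
open import Data.Integer using (+_)
open import Data.Rational using (ℚ; 0ℚ; 1ℚ; _/_) renaming (_+_ to _+ℚ_; _*_ to _*ℚ_; _≤_ to _≤ℚ_)
open import Relation.Binary.PropositionalEquality using (_≡_; _≢_)
open import Relation.Nullary using (¬_)

-- A 2×2 monomial matrix whose nonzero entries are m-th roots of unity.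
-- Fixing ζ = exp(2πi/m), an entry ζ^e is encoded by its exponent e ∈ ℤ/m = Fin m.
--   mon false e₁ e₂  =  [[ζ^e₁, 0], [0, ζ^e₂]]   (diagonal)
--   mon true  e₁ e₂  =  [[0, ζ^e₁], [ζ^e₂, 0]]   (antidiagonal)
record Mon (m : ℕ) : Set where
  constructor mon
  field
    anti : Bool
    e₁   : Fin m
    e₂   : Fin m

open Mon public

isZeroℕ : ℕ → ℕ
isZeroℕ zero    = 1
isZeroℕ (suc _) = 0

sumℚ : List ℚ → ℚ
sumℚ = foldr _+ℚ_ 0ℚ

module _ (m : ℕ) .{{_ : NonZero m}} where

  _⊕_ : Fin m → Fin m → Fin m
  a ⊕ b = (toℕ a + toℕ b) mod m

  ⊖_ : Fin m → Fin m
  ⊖ a = (m ∸ toℕ a) mod m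

  zeroE : Fin m
  zeroE = 0 mod m

  one : Mon m
  one = mon false zeroE zeroE

  _·_ : Mon m → Mon m → Mon m
  mon false a₁ a₂ · mon s b₁ b₂ = mon s (a₁ ⊕ b₁) (a₂ ⊕ b₂)
  mon true  a₁ a₂ · mon s b₁ b₂ = mon (not s) (a₁ ⊕ b₂) (a₂ ⊕ b₁)

  inv : Mon m → Mon m
  inv (mon false a₁ a₂) = mon false (⊖ a₁) (⊖ a₂)
  inv (mon true  a₁ a₂) = mon true (⊖ a₂) (⊖ a₁)

  -- membership in G(m,m,2): product of the nonzero entries is 1
  InW : Mon m → Set
  InW g = (e₁ g ⊕ e₂ g) ≡ zeroE

  -- dimension of the fixed space {x ∈ ℂ² : g x = x}
  -- (diagonal: number of diagonal entries equal to 1;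
  --  antidiagonal [[0,x],[y,0]]: 1 if xy = 1, else 0)
  fixDim : Mon m → ℕ
  fixDim (mon false a₁ a₂) = isZeroℕ (toℕ a₁) + isZeroℕ (toℕ a₂)
  fixDim (mon true  a₁ a₂) = isZeroℕ (toℕ (a₁ ⊕ a₂))

  IsRefl : Mon m → Set
  IsRefl g = InW g × (2 ∸ fixDim g ≡ 1)

  prod : List (Mon m) → Mon m
  prod = foldr _·_ one

  ℓR : Mon m → ℕ → Set
  ℓR w n = (∃[ rs ] (All IsRefl rs × length rs ≡ n × prod rs ≡ w))
         × (∀ rs → All IsRefl rs → prod rs ≡ w → n ≤ length rs)

  _≤A_ : Mon m → Mon m → Set
  u ≤A v = InW u × InW v ×
    ∃[ a ] ∃[ b ] ∃[ c ] (ℓR u a × ℓR (inv u · v) b × ℓR v c × a + b ≡ c)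

  _<A_ : Mon m → Mon m → Set
  u <A v = u ≤A v × u ≢ v

  _⋖_ : Mon m → Mon m → Set
  u ⋖ v = u <A v × ¬ (∃[ w ] (InW w × u <A w × w <A v))

  Rank : ℕ → Mon m → Set
  Rank i w = InW w × ℓR w i

  Enumerates : (Mon m → Set) → List (Mon m) → Set
  Enumerates P L = Unique L × (∀ x → x ∈ L → P x) × (∀ x → P x → x ∈ L)

  -- normalized flow on Abs(W) with weight ν ≡ 1 (so ν(x)/ν(P_i) = 1/|P_i|);
  -- "sum * |P_i| = 1" is used for "sum = 1/|P_i|" (|P_i| ≥ 1 in each case)
  IsNormalizedFlow : (Mon m → Mon m → ℚ) → Set
  IsNormalizedFlow f =
      (∀ a b → InW a → InW b → a ⋖ b → 0ℚ ≤ℚ f a b)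
    × (∀ i a → Rank i a → (∃[ b ] Rank (suc i) b) →
         ∃[ L ] ∃[ K ] (Enumerates (λ b → Rank (suc i) b × a ⋖ b) L
                       × Enumerates (Rank i) K
                       × sumℚ (map (f a) L) *ℚ (+ length K / 1) ≡ 1ℚ))
    × (∀ i b → Rank (suc i) b →
         ∃[ L ] ∃[ K ] (Enumerates (λ a → Rank i a × a ⋖ b) L
                       × Enumerates (Rank (suc i)) K
                       × sumℚ (map (λ a → f a b) L) *ℚ (+ length K / 1) ≡ 1ℚ))

  HasNormalizedFlow : Set
  HasNormalizedFlow = ∃[ f ] IsNormalizedFlow f

module Submission where

-- Idea: if every element of rank i in a ranked poset is covered by every element of
-- rank i + 1, then f(a,b) = 1/(|P_i|·|P_{i+1}|) for a of rank i is a normalized flow,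
-- because a has exactly |P_{i+1}| upper covers and b exactly |P_i| lower covers.
-- The theorem is the criterion applied to Abs(W).  (The construction works for every
-- m ≥ 1; the hypothesis m ≥ 2 only serves to exclude m = 0.)

open import Defs
open import Level using (0ℓ)
open import Algebra.Bundles using (AbelianGroup)
open import Algebra.Definitions using (Commutative; Associative; LeftIdentity; LeftInverse)
open import Data.Bool using (true; false)
open import Data.Empty using (⊥-elim)
open import Data.Nat using (ℕ; zero; suc; _+_; _∸_; _%_; _≤_; _<_; NonZero; s≤s; z≤n)
open import Data.Nat.Properties using (+-comm; +-assoc; m∸n+n≡m; ≤-antisym; 1+n≢n; ≤⇒≯; m<m+n)
open import Data.Nat.DivMod using (%-distribˡ-+; m%n%n≡m%n; m<n⇒m%n≡m; n%n≡0)
open import Data.Nat.Coprimality using (1-coprimeTo) renaming (sym to coprime-sym)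
open import Data.Fin using (Fin; toℕ) renaming (zero to fzero; suc to fsuc)
open import Data.Fin.Properties using (toℕ-injective; toℕ<n; toℕ≤n; toℕ-fromℕ<; suc-injective)
open import Data.Integer using (+_)
import Data.Integer as ℤ
open import Data.Integer.Tactic.RingSolver using (solve-∀)
open import Data.List using (List; []; _∷_; map; length; allFin)
open import Data.List.Membership.Propositional using (_∈_)
open import Data.List.Membership.Propositional.Properties using (∈-map⁺; ∈-map⁻; ∈-allFin)
open import Data.List.Relation.Unary.Any using (here; there)
open import Data.List.Relation.Unary.All using (All; []; _∷_)
open import Data.List.Relation.Unary.AllPairs using ([]; _∷_)
open import Data.List.Relation.Unary.Unique.Propositional using (Unique)
open import Data.List.Relation.Unary.Unique.Propositional.Properties using (map⁺; allFin⁺)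
open import Data.Product using (_×_; _,_; proj₁; proj₂; ∃-syntax)
open import Data.Rational using (ℚ; mkℚ; 0ℚ; 1ℚ; _/_; 1/_; NonNegative)
  renaming (_+_ to _+ℚ_; _*_ to _*ℚ_; _≤_ to _≤ℚ_)
open import Data.Rational.Properties
  using (normalize-coprime; toℚᵘ-injective; toℚᵘ-homo-+; nonNegative⁻¹; nonNeg*nonNeg⇒nonNeg;
         *-assoc; *-comm; *-identityˡ; *-inverseˡ; *-inverseʳ; *-zeroˡ; *-distribʳ-+)
open import Data.Rational.Unnormalised.Base using (*≡*)
import Data.Rational.Unnormalised.Properties as ℚᵘ
open import Relation.Nullary using (¬_)
open import Relation.Binary.PropositionalEquality

fromℕ : ℕ → ℚ
fromℕ n = mkℚ (+ n) 0 (coprime-sym (1-coprimeTo n))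

n/1≡fromℕ : ∀ n → + n / 1 ≡ fromℕ n
n/1≡fromℕ n = normalize-coprime (coprime-sym (1-coprimeTo n))

fromℕ-suc : ∀ n → fromℕ (suc n) ≡ 1ℚ +ℚ fromℕ n
fromℕ-suc n = toℚᵘ-injective
  (ℚᵘ.≃-trans (*≡* (cross-multiplied (+ n))) (ℚᵘ.≃-sym (toℚᵘ-homo-+ 1ℚ (fromℕ n))))
  where
  cross-multiplied : ∀ x → (+ 1 ℤ.+ x) ℤ.* + 1 ≡ (+ 1 ℤ.* + 1 ℤ.+ x ℤ.* + 1) ℤ.* (+ 1 ℤ.* + 1)
  cross-multiplied = solve-∀

sum-const : ∀ {A : Set} (g : A → ℚ) (c : ℚ) (L : List A) →
            (∀ {x} → x ∈ L → g x ≡ c) → sumℚ (map g L) ≡ fromℕ (length L) *ℚ c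
sum-const g c [] _ = sym (*-zeroˡ c)
sum-const g c (x ∷ L) g≡c = begin
  g x +ℚ sumℚ (map g L)             ≡⟨ cong₂ _+ℚ_ (g≡c (here refl)) (sum-const g c L (λ x∈ → g≡c (there x∈))) ⟩
  c +ℚ fromℕ (length L) *ℚ c        ≡⟨ cong (_+ℚ fromℕ (length L) *ℚ c) (*-identityˡ c) ⟨
  1ℚ *ℚ c +ℚ fromℕ (length L) *ℚ c  ≡⟨ *-distribʳ-+ c 1ℚ (fromℕ (length L)) ⟨
  (1ℚ +ℚ fromℕ (length L)) *ℚ c     ≡⟨ cong (_*ℚ c) (fromℕ-suc (length L)) ⟨
  fromℕ (suc (length L)) *ℚ c       ∎
  where open ≡-Reasoning

-- The reciprocal of a natural number, with the convention 1/0 = 0.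
1/ℕ : ℕ → ℚ
1/ℕ zero    = 0ℚ
1/ℕ (suc n) = 1/ fromℕ (suc n)

1/ℕ-nonNegative : ∀ n → NonNegative (1/ℕ n)
1/ℕ-nonNegative zero    = _
1/ℕ-nonNegative (suc n) = _

1/ℕ*1/ℕ-nonNeg : ∀ x y → 0ℚ ≤ℚ 1/ℕ x *ℚ 1/ℕ y
1/ℕ*1/ℕ-nonNeg x y = nonNegative⁻¹ (1/ℕ x *ℚ 1/ℕ y)
  {{nonNeg*nonNeg⇒nonNeg (1/ℕ x) {{1/ℕ-nonNegative x}} (1/ℕ y) {{1/ℕ-nonNegative y}}}}

reciprocal-balance : ∀ u v → (fromℕ (suc u) *ℚ (1/ℕ (suc u) *ℚ 1/ℕ (suc v))) *ℚ fromℕ (suc v) ≡ 1ℚ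
reciprocal-balance u v = begin
  (x *ℚ (1/ x *ℚ 1/ y)) *ℚ y  ≡⟨ cong (_*ℚ y) (*-assoc x (1/ x) (1/ y)) ⟨
  ((x *ℚ 1/ x) *ℚ 1/ y) *ℚ y  ≡⟨ cong (λ t → (t *ℚ 1/ y) *ℚ y) (*-inverseʳ x) ⟩
  (1ℚ *ℚ 1/ y) *ℚ y           ≡⟨ cong (_*ℚ y) (*-identityˡ (1/ y)) ⟩
  1/ y *ℚ y                   ≡⟨ *-inverseˡ y ⟩
  1ℚ                          ∎
  where
  open ≡-Reasoning
  x y : ℚ
  x = fromℕ (suc u)
  y = fromℕ (suc v)

balanced-sum : ∀ {A B : Set} (g : A → ℚ) (L : List A) (K : List B) {a : A} {b : B} →
               a ∈ L → b ∈ K → (∀ {x} → x ∈ L → g x ≡ 1/ℕ (length L) *ℚ 1/ℕ (length K)) →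
               sumℚ (map g L) *ℚ (+ length K / 1) ≡ 1ℚ
balanced-sum g L@(_ ∷ L′) K@(_ ∷ K′) _ _ g≡ = begin
  sumℚ (map g L) *ℚ (+ length K / 1)
    ≡⟨ cong₂ _*ℚ_ (sum-const g _ L g≡) (n/1≡fromℕ (length K)) ⟩
  (fromℕ (length L) *ℚ (1/ℕ (length L) *ℚ 1/ℕ (length K))) *ℚ fromℕ (length K)
    ≡⟨ reciprocal-balance (length L′) (length K′) ⟩
  1ℚ ∎
  where open ≡-Reasoning

enumerates-∧ : ∀ {m} .{{_ : NonZero m}} {P Q : Mon m → Set} {L : List (Mon m)} →
               Enumerates m P L → (∀ {x} → P x → Q x) → Enumerates m (λ x → P x × Q x) L
enumerates-∧ (unique , sound , complete) P⇒Q =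
  unique , (λ x x∈L → sound x x∈L , P⇒Q (sound x x∈L)) , (λ x (Px , _) → complete x Px)

module UniformFlow
  (m : ℕ) .{{_ : NonZero m}}
  (rank : Mon m → ℕ)
  (rank-correct : ∀ {i a} → Rank m i a → i ≡ rank a)
  (level : ℕ → List (Mon m))
  (level-enumerates : ∀ i → Enumerates m (Rank m i) (level i))
  (consecutive-covered : ∀ {i a b} → Rank m i a → Rank m (suc i) b → _⋖_ m a b)
  (lower-nonempty : ∀ {i b} → Rank m (suc i) b → ∃[ a ] Rank m i a)
  where

  size : ℕ → ℕ
  size i = length (level i)

  flow : Mon m → Mon m → ℚ
  flow a _ = 1/ℕ (size (rank a)) *ℚ 1/ℕ (size (suc (rank a)))

  flow-at-rank : ∀ {i a} (b : Mon m) → Rank m i a → flow a b ≡ 1/ℕ (size i) *ℚ 1/ℕ (size (suc i))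
  flow-at-rank _ ra rewrite rank-correct ra = refl

  member : ∀ {i x} → Rank m i x → x ∈ level i
  member {i} {x} = let (_ , _ , complete) = level-enumerates i in complete x

  rank-of-member : ∀ {i x} → x ∈ level i → Rank m i x
  rank-of-member {i} {x} = let (_ , sound , _) = level-enumerates i in sound x

  upper-covers : ∀ {i a} → Rank m i a → Enumerates m (λ b → Rank m (suc i) b × _⋖_ m a b) (level (suc i))
  upper-covers {i} ra = enumerates-∧ (level-enumerates (suc i)) (consecutive-covered ra)

  lower-covers : ∀ {i b} → Rank m (suc i) b → Enumerates m (λ a → Rank m i a × _⋖_ m a b) (level i)
  lower-covers {i} rb = enumerates-∧ (level-enumerates i) (λ ra → consecutive-covered ra rb)

  flow-nonNegative : ∀ a b → InW m a → InW m b → _⋖_ m a b → 0ℚ ≤ℚ flow a b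
  flow-nonNegative a _ _ _ _ = 1/ℕ*1/ℕ-nonNeg (size (rank a)) (size (suc (rank a)))

  -- a ∈ P_i sends 1/|P_i| up, spread evenly over its |P_{i+1}| upper covers
  outflow : ∀ i a → Rank m i a → (∃[ b ] Rank m (suc i) b) →
            ∃[ L ] ∃[ K ] (Enumerates m (λ b → Rank m (suc i) b × _⋖_ m a b) L
                          × Enumerates m (Rank m i) K
                          × sumℚ (map (flow a) L) *ℚ (+ length K / 1) ≡ 1ℚ)
  outflow i a ra (b , rb) =
    level (suc i) , level i , upper-covers ra , level-enumerates i ,
    balanced-sum (flow a) (level (suc i)) (level i) (member rb) (member ra)
      (λ {x} _ → trans (flow-at-rank x ra) (*-comm (1/ℕ (size i)) (1/ℕ (size (suc i)))))

  -- b ∈ P_{i+1} receives 1/|P_{i+1}|, evenly from its |P_i| lower covers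
  inflow : ∀ i b → Rank m (suc i) b →
           ∃[ L ] ∃[ K ] (Enumerates m (λ a → Rank m i a × _⋖_ m a b) L
                         × Enumerates m (Rank m (suc i)) K
                         × sumℚ (map (λ a → flow a b) L) *ℚ (+ length K / 1) ≡ 1ℚ)
  inflow i b rb =
    level i , level (suc i) , lower-covers rb , level-enumerates (suc i) ,
    balanced-sum (λ a → flow a b) (level i) (level (suc i)) (member (proj₂ (lower-nonempty rb))) (member rb)
      (λ x∈ → flow-at-rank b (rank-of-member x∈))

  uniform-flow : HasNormalizedFlow m
  uniform-flow = flow , flow-nonNegative , outflow , inflow

-- An entry ζ^e is stored as its exponent e ∈ ℤ/m (here m = n + 1); multiplying and
-- inverting entries is addition and negation of exponents, which form an abelian group.
module ExponentGroup (n : ℕ) where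

  m : ℕ
  m = suc n

  infixl 6 _⊕ₘ_
  _⊕ₘ_ : Fin m → Fin m → Fin m
  _⊕ₘ_ = _⊕_ m

  toℕ-⊕ : ∀ a b → toℕ (a ⊕ₘ b) ≡ (toℕ a + toℕ b) % m
  toℕ-⊕ a b = toℕ-fromℕ< _

  toℕ-⊖ : ∀ a → toℕ (⊖_ m a) ≡ (m ∸ toℕ a) % m
  toℕ-⊖ a = toℕ-fromℕ< _

  %-absorbˡ : ∀ x y → (x % m + y) % m ≡ (x + y) % m
  %-absorbˡ x y = begin
    (x % m + y) % m          ≡⟨ %-distribˡ-+ (x % m) y m ⟩
    (x % m % m + y % m) % m  ≡⟨ cong (λ t → (t + y % m) % m) (m%n%n≡m%n x m) ⟩
    (x % m + y % m) % m      ≡⟨ %-distribˡ-+ x y m ⟨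
    (x + y) % m              ∎
    where open ≡-Reasoning

  ⊕-comm : Commutative _≡_ _⊕ₘ_
  ⊕-comm a b = toℕ-injective (begin
    toℕ (a ⊕ₘ b)           ≡⟨ toℕ-⊕ a b ⟩
    (toℕ a + toℕ b) % m    ≡⟨ cong (_% m) (+-comm (toℕ a) (toℕ b)) ⟩
    (toℕ b + toℕ a) % m    ≡⟨ toℕ-⊕ b a ⟨
    toℕ (b ⊕ₘ a)           ∎)
    where open ≡-Reasoning

  ⊕-assoc : Associative _≡_ _⊕ₘ_
  ⊕-assoc a b c = toℕ-injective (begin
    toℕ (a ⊕ₘ b ⊕ₘ c)                    ≡⟨ toℕ-⊕ (a ⊕ₘ b) c ⟩
    (toℕ (a ⊕ₘ b) + toℕ c) % m           ≡⟨ cong (λ t → (t + toℕ c) % m) (toℕ-⊕ a b) ⟩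
    ((toℕ a + toℕ b) % m + toℕ c) % m    ≡⟨ %-absorbˡ (toℕ a + toℕ b) (toℕ c) ⟩
    (toℕ a + toℕ b + toℕ c) % m          ≡⟨ cong (_% m) (+-assoc (toℕ a) (toℕ b) (toℕ c)) ⟩
    (toℕ a + (toℕ b + toℕ c)) % m        ≡⟨ cong (_% m) (+-comm (toℕ a) (toℕ b + toℕ c)) ⟩
    ((toℕ b + toℕ c) + toℕ a) % m        ≡⟨ %-absorbˡ (toℕ b + toℕ c) (toℕ a) ⟨
    ((toℕ b + toℕ c) % m + toℕ a) % m    ≡⟨ cong (λ t → (t + toℕ a) % m) (toℕ-⊕ b c) ⟨
    (toℕ (b ⊕ₘ c) + toℕ a) % m           ≡⟨ toℕ-⊕ (b ⊕ₘ c) a ⟨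
    toℕ (b ⊕ₘ c ⊕ₘ a)                    ≡⟨ cong toℕ (⊕-comm (b ⊕ₘ c) a) ⟩
    toℕ (a ⊕ₘ (b ⊕ₘ c))                  ∎)
    where open ≡-Reasoning

  ⊕-identityˡ : LeftIdentity _≡_ (zeroE m) _⊕ₘ_
  ⊕-identityˡ a = toℕ-injective (trans (toℕ-⊕ (zeroE m) a) (m<n⇒m%n≡m (toℕ<n a)))

  ⊕-inverseˡ : LeftInverse _≡_ (zeroE m) (⊖_ m) _⊕ₘ_
  ⊕-inverseˡ a = toℕ-injective (begin
    toℕ (⊖_ m a ⊕ₘ a)                ≡⟨ toℕ-⊕ (⊖_ m a) a ⟩
    (toℕ (⊖_ m a) + toℕ a) % m       ≡⟨ cong (λ t → (t + toℕ a) % m) (toℕ-⊖ a) ⟩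
    ((m ∸ toℕ a) % m + toℕ a) % m    ≡⟨ %-absorbˡ (m ∸ toℕ a) (toℕ a) ⟩
    (m ∸ toℕ a + toℕ a) % m          ≡⟨ cong (_% m) (m∸n+n≡m (toℕ≤n a)) ⟩
    m % m                            ≡⟨ n%n≡0 m ⟩
    0                                ∎)
    where open ≡-Reasoning

  -- with commutativity, the left identity and inverse laws give the right ones
  ℤₘ : AbelianGroup 0ℓ 0ℓ
  ℤₘ = record
    { Carrier = Fin m
    ; _≈_ = _≡_
    ; _∙_ = _⊕ₘ_
    ; ε = zeroE m
    ; _⁻¹ = ⊖_ m
    ; isAbelianGroup = record
      { isGroup = record
        { isMonoid = record
          { isSemigroup = record
            { isMagma = record { isEquivalence = isEquivalence ; ∙-cong = cong₂ _⊕ₘ_ }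
            ; assoc = ⊕-assoc }
          ; identity = ⊕-identityˡ , λ a → trans (⊕-comm a (zeroE m)) (⊕-identityˡ a) }
        ; inverse = ⊕-inverseˡ , λ a → trans (⊕-comm a (⊖_ m a)) (⊕-inverseˡ a)
        ; ⁻¹-cong = cong (⊖_ m) }
      ; comm = ⊕-comm }
    }

module AbsoluteOrder (n : ℕ) where

  open ExponentGroup n using (m; ℤₘ)
  open AbelianGroup ℤₘ using (ε; _∙_; _⁻¹; identityʳ; inverseʳ; comm; group; commutativeSemigroup)
  open import Algebra.Properties.Group group using (inverseʳ-unique; ⁻¹-involutive; ⁻¹-injective; ε⁻¹≈ε)
  open import Algebra.Properties.AbelianGroup ℤₘ using (⁻¹-∙-comm)
  open import Algebra.Properties.CommutativeSemigroup commutativeSemigroup using (interchange)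

  W : Mon m → Set
  W = InW m

  infixl 7 _·ₘ_
  _·ₘ_ : Mon m → Mon m → Mon m
  _·ₘ_ = _·_ m

  invₘ : Mon m → Mon m
  invₘ = inv m

  1ₘ : Mon m
  1ₘ = one m

  infix 4 _≤ₐ_ _<ₐ_ _⋖ₐ_
  _≤ₐ_ _<ₐ_ _⋖ₐ_ : Mon m → Mon m → Set
  _≤ₐ_ = _≤A_ m
  _<ₐ_ = _<A_ m
  _⋖ₐ_ = _⋖_ m

  W-form : ∀ {s a b} → W (mon s a b) → b ≡ a ⁻¹
  W-form {a = a} {b} = inverseʳ-unique a b

  W-one : W 1ₘ
  W-one = identityʳ ε

  W-· : ∀ x y → W x → W y → W (x ·ₘ y)
  W-· (mon false a₁ a₂) (mon _ b₁ b₂) wx wy = begin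
    (a₁ ∙ b₁) ∙ (a₂ ∙ b₂)  ≡⟨ interchange a₁ b₁ a₂ b₂ ⟩
    (a₁ ∙ a₂) ∙ (b₁ ∙ b₂)  ≡⟨ cong₂ _∙_ wx wy ⟩
    ε ∙ ε                  ∎
    where open ≡-Reasoning
  W-· (mon true a₁ a₂) (mon _ b₁ b₂) wx wy = begin
    (a₁ ∙ b₂) ∙ (a₂ ∙ b₁)  ≡⟨ interchange a₁ b₂ a₂ b₁ ⟩
    (a₁ ∙ a₂) ∙ (b₂ ∙ b₁)  ≡⟨ cong₂ _∙_ wx (trans (comm b₂ b₁) wy) ⟩
    ε ∙ ε                  ∎
    where open ≡-Reasoning

  W-inv : ∀ x → W x → W (invₘ x)
  W-inv (mon false a₁ a₂) w = trans (⁻¹-∙-comm a₁ a₂) (trans (cong _⁻¹ w) ε⁻¹≈ε)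
  W-inv (mon true a₁ a₂) w =
    trans (⁻¹-∙-comm a₂ a₁) (trans (cong _⁻¹ (trans (comm a₂ a₁) w)) ε⁻¹≈ε)

  cancelₑ : ∀ a b → a ⁻¹ ∙ b ≡ ε → a ≡ b
  cancelₑ a b e = sym (trans (inverseʳ-unique (a ⁻¹) b e) (⁻¹-involutive a))

  inv-cancel : ∀ u v → invₘ u ·ₘ v ≡ 1ₘ → u ≡ v
  inv-cancel (mon false a₁ a₂) (mon false b₁ b₂) e =
    cong₂ (mon false) (cancelₑ a₁ b₁ (cong e₁ e)) (cancelₑ a₂ b₂ (cong e₂ e))
  inv-cancel (mon true a₁ a₂) (mon true b₁ b₂) e =
    cong₂ (mon true) (cancelₑ a₁ b₁ (cong e₂ e)) (cancelₑ a₂ b₂ (cong e₁ e))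

  -- An antidiagonal element of W fixes exactly the line spanned by (ζ^a, 1): a reflection.
  antidiagonal-reflection : ∀ x → W x → anti x ≡ true → IsRefl m x
  antidiagonal-reflection (mon true a b) w _ = w , cong (λ t → 2 ∸ isZeroℕ (toℕ t)) w

  ⁻¹-nonzero : ∀ {a} → a ≢ ε → a ⁻¹ ≢ ε
  ⁻¹-nonzero a≢ε a⁻¹≡ε = a≢ε (⁻¹-injective (trans a⁻¹≡ε (sym ε⁻¹≈ε)))

  -- A diagonal element of W fixes either all of ℂ² (a = 0) or only 0 (a ≠ 0),
  -- so it is never a reflection.
  diagonal-not-reflection : ∀ a → 2 ∸ fixDim m (mon false a (a ⁻¹)) ≢ 1
  diagonal-not-reflection fzero rewrite ε⁻¹≈ε = λ ()
  diagonal-not-reflection (fsuc k) with fsuc k ⁻¹ in a⁻¹≡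
  ... | fzero  = ⊥-elim (⁻¹-nonzero {fsuc k} (λ ()) a⁻¹≡)
  ... | fsuc _ = λ ()

  reflection-antidiagonal : ∀ x → IsRefl m x → anti x ≡ true
  reflection-antidiagonal (mon true _ _) _ = refl
  reflection-antidiagonal (mon false a b) (w , line) = ⊥-elim
    (diagonal-not-reflection a (subst (λ c → 2 ∸ fixDim m (mon false a c) ≡ 1) (W-form {false} {a} w) line))

  ℓR-functional : ∀ {w i j} → ℓR m w i → ℓR m w j → i ≡ j
  ℓR-functional ((rs , refl-rs , len-rs , prod-rs) , minimal) ((rs′ , refl-rs′ , len-rs′ , prod-rs′) , minimal′) =
    ≤-antisym (subst (_ ≤_) len-rs′ (minimal rs′ refl-rs′ prod-rs′))
              (subst (_ ≤_) len-rs (minimal′ rs refl-rs prod-rs))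

  ℓR-zero : ∀ {w} → ℓR m w 0 → w ≡ 1ₘ
  ℓR-zero (([] , _ , _ , prod-rs) , _) = sym prod-rs

  ℓR-one : ℓR m 1ₘ 0
  ℓR-one = ([] , [] , refl , refl) , λ _ _ _ → z≤n

  ℓR-antidiagonal : ∀ {x} → W x → anti x ≡ true → ℓR m x 1
  ℓR-antidiagonal {x@(mon true a b)} w anti-x =
    (x ∷ [] , antidiagonal-reflection x w anti-x ∷ [] , refl , cong₂ (mon true) (identityʳ a) (identityʳ b)) ,
    λ { [] _ () ; (_ ∷ _) _ _ → s≤s z≤n }

  -- A nontrivial rotation is the product of two reflections, and of no fewer:
  -- the empty product is the identity and a single reflection is antidiagonal.
  ℓR-rotation : ∀ {a b} → W (mon false (fsuc a) b) → ℓR m (mon false (fsuc a) b) 2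
  ℓR-rotation {a} {b} w =
    (mon true (fsuc a) b ∷ mon true ε ε ∷ [] ,
     antidiagonal-reflection (mon true (fsuc a) b) w refl ∷ antidiagonal-reflection (mon true ε ε) W-one refl ∷ [] , refl ,
     cong₂ (mon false) (identityʳ (fsuc a)) (identityʳ b)) ,
    at-least-two
    where
    at-least-two : ∀ rs → All (IsRefl m) rs → prod m rs ≡ mon false (fsuc a) b → 2 ≤ length rs
    at-least-two [] _ ()
    at-least-two (mon true _ _ ∷ []) _ ()
    at-least-two (r@(mon false _ _) ∷ []) (r-refl ∷ []) _ with reflection-antidiagonal r r-refl
    ... | ()
    at-least-two (_ ∷ _ ∷ _) _ _ = s≤s (s≤s z≤n)

  -- The rank of an element of W: 0 for the identity, 1 for the antidiagonal reflections,
  -- 2 for the nontrivial rotations (the first exponent of a diagonal element is 0 exactly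
  -- for the identity).
  rank : Mon m → ℕ
  rank (mon true _ _)         = 1
  rank (mon false fzero _)    = 0
  rank (mon false (fsuc _) _) = 2

  ℓR-rank : ∀ w → W w → ℓR m w (rank w)
  ℓR-rank (mon true a b)         w = ℓR-antidiagonal w refl
  ℓR-rank (mon false fzero b)    w = subst (λ c → ℓR m (mon false fzero c) 0) (sym b≡ε) ℓR-one
    where
    b≡ε : b ≡ ε
    b≡ε = trans (W-form {false} {fzero} w) ε⁻¹≈ε
  ℓR-rank (mon false (fsuc a) b) w = ℓR-rotation w

  rank-correct : ∀ {i w} → Rank m i w → i ≡ rank w
  rank-correct {w = w} (w∈W , ℓw) = ℓR-functional ℓw (ℓR-rank w w∈W)

  -- The strict absolute order strictly raises reflection length: if u < w then
  -- ℓR(u⁻¹w) ≠ 0, as otherwise u = w.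
  <ₐ-raises-ℓR : ∀ {u w i k} → u <ₐ w → ℓR m u i → ℓR m w k → i < k
  <ₐ-raises-ℓR {u} {w} ((_ , _ , _ , zero , _ , _ , ℓq , _ , _) , u≢w) _ _ =
    ⊥-elim (u≢w (inv-cancel u w (ℓR-zero ℓq)))
  <ₐ-raises-ℓR ((_ , _ , a , suc _ , _ , ℓu , _ , ℓw , a+b≡c) , _) ℓu′ ℓw′ =
    subst₂ _<_ (ℓR-functional ℓu ℓu′) (trans a+b≡c (ℓR-functional ℓw ℓw′)) (m<m+n a (s≤s z≤n))

  ≤ₐ-cover : ∀ {u v i} → u ≤ₐ v → ℓR m u i → ℓR m v (suc i) → u ⋖ₐ v
  ≤ₐ-cover {u} {v} {i} u≤v ℓu ℓv = (u≤v , u≢v) , no-middle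
    where
    u≢v : u ≢ v
    u≢v refl = 1+n≢n (sym (ℓR-functional ℓu ℓv))
    no-middle : ¬ (∃[ w ] (W w × u <ₐ w × w <ₐ v))
    no-middle (w , _ , u<w , w<v) =
      let (_ , _ , _ , _ , _ , _ , _ , ℓw , _) = proj₁ u<w
      in ≤⇒≯ (<ₐ-raises-ℓR u<w ℓu ℓw) (<ₐ-raises-ℓR w<v ℓw ℓv)

  -- Between consecutive ranks exactly one of u, v is antidiagonal, hence so is u⁻¹v.
  consecutive-antidiagonal : ∀ u v → rank v ≡ suc (rank u) → anti (invₘ u ·ₘ v) ≡ true
  consecutive-antidiagonal (mon true _ _)  (mon false _ _) _ = refl
  consecutive-antidiagonal (mon false _ _) (mon true _ _)  _ = refl
  consecutive-antidiagonal (mon true _ _)  (mon true _ _)  ()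
  consecutive-antidiagonal (mon false fzero _)    (mon false fzero _)    ()
  consecutive-antidiagonal (mon false fzero _)    (mon false (fsuc _) _) ()
  consecutive-antidiagonal (mon false (fsuc _) _) (mon false fzero _)    ()
  consecutive-antidiagonal (mon false (fsuc _) _) (mon false (fsuc _) _) ()

  consecutive-covered : ∀ {i u v} → Rank m i u → Rank m (suc i) v → u ⋖ₐ v
  consecutive-covered {i} {u} {v} ru@(u∈W , ℓu) rv@(v∈W , ℓv) =
    ≤ₐ-cover (u∈W , v∈W , i , 1 , suc i , ℓu , ℓR-antidiagonal q∈W q-anti , ℓv , +-comm i 1) ℓu ℓv
    where
    q∈W : W (invₘ u ·ₘ v)
    q∈W = W-· (invₘ u) v (W-inv u u∈W) v∈W
    q-anti : anti (invₘ u ·ₘ v) ≡ true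
    q-anti = consecutive-antidiagonal u v (trans (sym (rank-correct rv)) (cong suc (rank-correct ru)))

  -- The reflections ρ a = [[0, ζ^a], [ζ^-a, 0]] and the nontrivial rotations
  -- σ a = diag(ζ^(a+1), ζ^-(a+1)).
  ρ : Fin m → Mon m
  ρ a = mon true a (a ⁻¹)

  σ : Fin n → Mon m
  σ a = mon false (fsuc a) (fsuc a ⁻¹)

  level : ℕ → List (Mon m)
  level 0 = 1ₘ ∷ []
  level 1 = map ρ (allFin m)
  level 2 = map σ (allFin n)
  level (suc (suc (suc _))) = []

  level-unique : ∀ i → Unique (level i)
  level-unique 0 = [] ∷ []
  level-unique 1 = map⁺ (cong e₁) (allFin⁺ m)
  level-unique 2 = map⁺ (λ σa≡σb → suc-injective (cong e₁ σa≡σb)) (allFin⁺ n)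
  level-unique (suc (suc (suc _))) = []

  level-sound : ∀ i {x} → x ∈ level i → W x × rank x ≡ i
  level-sound 0 (here refl) = W-one , refl
  level-sound 1 x∈ with ∈-map⁻ ρ x∈
  ... | a , _ , refl = inverseʳ a , refl
  level-sound 2 x∈ with ∈-map⁻ σ x∈
  ... | a , _ , refl = inverseʳ (fsuc a) , refl

  level-complete : ∀ x → W x → x ∈ level (rank x)
  level-complete (mon true a b) w =
    subst (λ c → mon true a c ∈ level 1) (sym (W-form {true} {a} w)) (∈-map⁺ ρ (∈-allFin a))
  level-complete (mon false fzero b) w =
    here (cong (mon false fzero) (trans (W-form {false} {fzero} w) ε⁻¹≈ε))
  level-complete (mon false (fsuc a) b) w =
    subst (λ c → mon false (fsuc a) c ∈ level 2) (sym (W-form {false} {fsuc a} w)) (∈-map⁺ σ (∈-allFin a))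

  level-enumerates : ∀ i → Enumerates m (Rank m i) (level i)
  level-enumerates i = level-unique i , sound , complete
    where
    sound : ∀ x → x ∈ level i → Rank m i x
    sound x x∈ = let (x∈W , rank≡i) = level-sound i x∈ in x∈W , subst (ℓR m x) rank≡i (ℓR-rank x x∈W)
    complete : ∀ x → Rank m i x → x ∈ level i
    complete x rx@(x∈W , _) = subst (λ j → x ∈ level j) (sym (rank-correct rx)) (level-complete x x∈W)

  lower-nonempty : ∀ {i v} → Rank m (suc i) v → ∃[ u ] Rank m i u
  lower-nonempty {i} {v} rv = below v (rank-correct rv)
    where
    below : ∀ v → suc i ≡ rank v → ∃[ u ] Rank m i u
    below (mon true _ _)         refl = 1ₘ , W-one , ℓR-one
    below (mon false (fsuc _) _) refl = ρ ε , inverseʳ ε , ℓR-antidiagonal (inverseʳ ε) refl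

proposition3p5 : (m : ℕ) .{{_ : NonZero m}} → 2 ≤ m → HasNormalizedFlow m
proposition3p5 zero    ()
proposition3p5 (suc n) _  =
  UniformFlow.uniform-flow (suc n) rank rank-correct level level-enumerates
    consecutive-covered lower-nonempty
  where open AbsoluteOrder n
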